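{- (i) There are exactly 1296 $(S_c,I_c)$-clonoids; they are the sets $A\cup B\cup C\cup D$ where $A\in\{\emptyset,C_0,\mathrm{Refl}_{00},\mathrm{Smin}_{00},\mathrm{Refl}_{00}\cup\mathrm{Smin}_{00},\Omega_{00}\}$, $B\in\{\emptyset,S_{01},\mathrm{Smaj}_{01},\mathrm{Smin}_{01},\mathrm{Smaj}_{01}\cup\mathrm{Smin}_{01},\Omega_{01}\}$, $C\in\{\emptyset,S_{10},\mathrm{Smaj}_{10},\mathrm{Smin}_{10},\mathrm{Smaj}_{10}\cup\mathrm{Smin}_{10},\Omega_{10}\}$, $D\in\{\emptyset,C_1,\mathrm{Smaj}_{11},\mathrm{Refl}_{11},\mathrm{Smaj}_{11}\cup\mathrm{Refl}_{11},\Omega_{11}\}$; the lattice of $(S_c,I_c)$-clonoids is isomorphic to the direct product of four 6-element lattices (each of the four displayed families ordered by inclusion), via $(A,B,C,D)\mapsto A\cup B\cup C\cup D$. (ii) There are exactly 19 $(S,I_c)$-clonoids: $\Omega$, $\mathrm{Refl}\cup\mathrm{Smin}\cup\mathrm{Smaj}$, $\mathrm{Refl}\cup\mathrm{Smin}$, $\mathrm{Refl}\cup\mathrm{Smaj}$, $\mathrm{Smin}\cup\mathrm{Smaj}$, $\mathrm{Smaj}\cup C_0$, $\mathrm{Smin}\cup C_1$, $\mathrm{Refl}\cup S$, $\mathrm{Smin}$, $\mathrm{Smaj}$, $\mathrm{Refl}$, $S\cup C$, $S\cup C_0$, $S\cup C_1$, $S$, $C$, $C_0$, $C_1$, $\emptyset$.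 (iii) There are exactly 36 $(\Omega_{01},I_c)$-clonoids; they are the sets $A\cup B\cup C\cup D$ with $A\in\{\emptyset,C_0,\Omega_{00}\}$, $B\in\{\emptyset,\Omega_{01}\}$, $C\in\{\emptyset,\Omega_{10}\}$, $D\in\{\emptyset,C_1,\Omega_{11}\}$. (iv) There are exactly 9 $(\Omega_{0*},I_c)$-clonoids; they are the sets $A\cup B$ with $A\in\{\emptyset,C_0,\Omega_{0*}\}$, $B\in\{\emptyset,C_1,\Omega_{1*}\}$. (v) There are exactly 9 $(\Omega_{*1},I_c)$-clonoids; they are the sets $A\cup B$ with $A\in\{\emptyset,C_0,\Omega_{*0}\}$, $B\in\{\emptyset,C_1,\Omega_{*1}\}$. (vi) There are exactly 5 $(\Omega,I_c)$-clonoids: $\Omega$, $C$, $C_0$, $C_1$, $\emptyset$.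
   Context: A Boolean function is $f\colon\{0,1\}^n\to\{0,1\}$, $n\ge1$; $\Omega$ is the set of all of them. For sets $I,J$ of Boolean functions, $IJ:=\{f(g_1,\dots,g_n): f\in I\ n\text{ -ary},\ g_i\in J \text{ all } m\text{ -ary}\}$. A clone is a set of Boolean functions containing all projections and closed under composition. For clones $C_1,C_2$, a $(C_1,C_2)$-clonoid is $K\subseteq\Omega$ with $KC_1\subseteq K$ and $C_2K\subseteq K$. $I_c$ is the clone of projections. $\mathbf0,\mathbf1$ are the all-0, all-1 tuples; for $\mathbf a\in\{0,1\}^n$, $\overline{\mathbf a}$ is its componentwise negation. $\Omega_{ab}=\{f:f(\mathbf0)=a,f(\mathbf1)=b\}$, $\Omega_{a*}=\{f:f(\mathbf0)=a\}$, $\Omega_{*b}=\{f:f(\mathbf1)=b\}$ (the sets $\Omega_{01},\Omega_{0*},\Omega_{*1}$ are clones); for $K\subseteq\Omega$, $K_{ab}=K\cap\Omega_{ab}$. $C_0$, $C_1$: constant functions (all arities) with value $0$, resp. $1$; $C=C_0\cup C_1$. $S=\{f: f(\overline{\mathbf a})\neq f(\mathbf a)\ \forall \mathbf a\}$ (self-dual functions), $S_c=S_{01}$. $\mathrm{Refl}=\{f: f(\overline{\mathbf a})=f(\mathbf a)\ \forall\mathbf a\}$; $\mathrm{Smin}=\{f: f(\mathbf a)\wedge f(\overline{\mathbf a})=0\ \forall \mathbf a\}$ (minorants of self-dual functions); $\mathrm{Smaj}=\{f: f(\mathbf a)\vee f(\overline{\mathbf a})=1\ \forall\mathbf a\}$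 (majorants of self-dual functions). -}

module Defs where

open import Data.Bool using (Bool; true; false; not; _∧_; _∨_; if_then_else_)
open import Data.Nat using (ℕ; zero; suc)
open import Data.Fin using (Fin)
open import Data.Fin.Patterns
open import Data.Vec using (Vec; []; _∷_; lookup; tabulate; replicate; map)
open import Data.Product using (Σ; ∃; ∃-syntax; _×_; _,_)
open import Data.Sum using (_⊎_)
open import Data.Unit using (⊤)
open import Data.Empty using (⊥)
open import Relation.Nullary using (¬_)
open import Relation.Binary.PropositionalEquality using (_≡_)

-- Boolean functions, represented canonically by their truth tables
-- (Shannon decomposition on the first variable), so that two Boolean
-- functions are equal iff they are extensionally equal.

BF : ℕ → Set
BF zero    = Bool
BF (suc n) = BF n × BF n

eval : ∀ {n} → BF n → Vec Bool n → Bool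
eval {zero}  b         []       = b
eval {suc n} (f0 , f1) (x ∷ xs) = eval (if x then f1 else f0) xs

tab : ∀ {n} → (Vec Bool n → Bool) → BF n
tab {zero}  g = g []
tab {suc n} g = tab (λ xs → g (false ∷ xs)) , tab (λ xs → g (true ∷ xs))

comp : ∀ {k m} → BF k → (Fin k → BF m) → BF m
comp f g = tab (λ x → eval f (tabulate (λ i → eval (g i) x)))

-- Sets of Boolean functions.  Arities are ≥ 1: `K n f` means that the
-- (suc n)-ary function f belongs to K.

BSet : Set₁
BSet = (n : ℕ) → BF (suc n) → Set

∅ : BSet
∅ _ _ = ⊥

Ω : BSet
Ω _ _ = ⊤

infixr 6 _∪_
infixr 7 _∩_

_∪_ : BSet → BSet → BSet
(K ∪ L) n f = K n f ⊎ L n f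

_∩_ : BSet → BSet → BSet
(K ∩ L) n f = K n f × L n f

_⊆_ : BSet → BSet → Set
K ⊆ L = ∀ n f → K n f → L n f

_≐_ : BSet → BSet → Set
K ≐ L = K ⊆ L × L ⊆ K

-- I J ⊆ K  (I J = { f(g₁,…,g_k) : f ∈ I k-ary, gᵢ ∈ J all m-ary })
CompIn : BSet → BSet → BSet → Set
CompIn I J K = ∀ k m (f : BF (suc k)) (g : Fin (suc k) → BF (suc m)) →
  I k f → (∀ i → J m (g i)) → K m (comp f g)

IsClonoid : BSet → BSet → BSet → Set
IsClonoid C₁ C₂ K = CompIn K C₁ K × CompIn C₂ K K

𝟎 𝟏 : ∀ {n} → Vec Bool n
𝟎 = replicate _ false
𝟏 = replicate _ true

neg : ∀ {n} → Vec Bool n → Vec Bool n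
neg = map not

Ic : BSet
Ic n f = ∃[ i ] (∀ a → eval f a ≡ lookup a i)

Ωab : Bool → Bool → BSet
Ωab a b n f = eval f 𝟎 ≡ a × eval f 𝟏 ≡ b

Ωa* : Bool → BSet
Ωa* a n f = eval f 𝟎 ≡ a

Ω*b : Bool → BSet
Ω*b b n f = eval f 𝟏 ≡ b

_[_,_] : BSet → Bool → Bool → BSet
K [ a , b ] = K ∩ Ωab a b

C₀ C₁ C : BSet
C₀ n f = ∀ a → eval f a ≡ false
C₁ n f = ∀ a → eval f a ≡ true
C = C₀ ∪ C₁

S Sc Refl Smin Smaj : BSet
S n f    = ∀ a → ¬ (eval f (neg a) ≡ eval f a)
Sc       = S [ false , true ]
Refl n f = ∀ a → eval f (neg a) ≡ eval f a
Smin n f = ∀ a → (eval f a ∧ eval f (neg a)) ≡ false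
Smaj n f = ∀ a → (eval f a ∨ eval f (neg a)) ≡ true

-- "The (C₁,C₂)-clonoids are exactly the sets U i, i ∈ Idx, pairwise
-- distinct":  each U i is a clonoid, every clonoid equals some U i,
-- and U is injective (up to equality of sets).  Hence the number of
-- clonoids is the cardinality of Idx.

Classification : BSet → BSet → (Idx : Set) → (Idx → BSet) → Set₁
Classification C₁ C₂ Idx U =
  (∀ i → IsClonoid C₁ C₂ (U i)) ×
  (∀ (K : BSet) → IsClonoid C₁ C₂ K → ∃[ i ] (K ≐ U i)) ×
  (∀ i j → U i ≐ U j → i ≡ j)

famA famB famC famD : Fin 6 → BSet
famA 0F = ∅
famA 1F = C₀
famA 2F = Refl [ false , false ]
famA 3F = Smin [ false , false ]
famA 4F = Refl [ false , false ] ∪ Smin [ false , false ]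
famA 5F = Ωab false false

famB 0F = ∅
famB 1F = S [ false , true ]
famB 2F = Smaj [ false , true ]
famB 3F = Smin [ false , true ]
famB 4F = Smaj [ false , true ] ∪ Smin [ false , true ]
famB 5F = Ωab false true

famC 0F = ∅
famC 1F = S [ true , false ]
famC 2F = Smaj [ true , false ]
famC 3F = Smin [ true , false ]
famC 4F = Smaj [ true , false ] ∪ Smin [ true , false ]
famC 5F = Ωab true false

famD 0F = ∅
famD 1F = C₁
famD 2F = Smaj [ true , true ]
famD 3F = Refl [ true , true ]
famD 4F = Smaj [ true , true ] ∪ Refl [ true , true ]
famD 5F = Ωab true true

Idx-i : Set
Idx-i = Fin 6 × Fin 6 × Fin 6 × Fin 6

U-i : Idx-i → BSet
U-i (a , b , c , d) = famA a ∪ famB b ∪ famC c ∪ famD d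

_≤-i_ : Idx-i → Idx-i → Set
(a , b , c , d) ≤-i (a' , b' , c' , d') =
  famA a ⊆ famA a' × famB b ⊆ famB b' × famC c ⊆ famC c' × famD d ⊆ famD d'

U-ii : Fin 19 → BSet
U-ii i = lookup
  ( Ω
  ∷ Refl ∪ Smin ∪ Smaj
  ∷ Refl ∪ Smin
  ∷ Refl ∪ Smaj
  ∷ Smin ∪ Smaj
  ∷ Smaj ∪ C₀
  ∷ Smin ∪ C₁
  ∷ Refl ∪ S
  ∷ Smin
  ∷ Smaj
  ∷ Refl
  ∷ S ∪ C
  ∷ S ∪ C₀
  ∷ S ∪ C₁
  ∷ S
  ∷ C
  ∷ C₀
  ∷ C₁
  ∷ ∅
  ∷ []) i

Idx-iii : Set
Idx-iii = Fin 3 × Fin 2 × Fin 2 × Fin 3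

U-iii : Idx-iii → BSet
U-iii (a , b , c , d) = A a ∪ B b ∪ C' c ∪ D d
  where
  A : Fin 3 → BSet
  A 0F = ∅
  A 1F = C₀
  A 2F = Ωab false false
  B : Fin 2 → BSet
  B 0F = ∅
  B 1F = Ωab false true
  C' : Fin 2 → BSet
  C' 0F = ∅
  C' 1F = Ωab true false
  D : Fin 3 → BSet
  D 0F = ∅
  D 1F = C₁
  D 2F = Ωab true true

U-iv : Fin 3 × Fin 3 → BSet
U-iv (a , b) = A a ∪ B b
  where
  A B : Fin 3 → BSet
  A 0F = ∅
  A 1F = C₀
  A 2F = Ωa* false
  B 0F = ∅
  B 1F = C₁
  B 2F = Ωa* true

U-v : Fin 3 × Fin 3 → BSet
U-v (a , b) = A a ∪ B b
  where
  A B : Fin 3 → BSet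
  A 0F = ∅
  A 1F = C₀
  A 2F = Ω*b false
  B 0F = ∅
  B 1F = C₁
  B 2F = Ω*b true

U-vi : Fin 5 → BSet
U-vi 0F = Ω
U-vi 1F = C
U-vi 2F = C₀
U-vi 3F = C₁
U-vi 4F = ∅

-- Whether h lies in every (C, I_c)-clonoid containing f depends only on a five-bit signature of
-- h and f: the values at 𝟎 and 𝟏, and which of the pair types {0,0}, {1,1}, {0,1} occur among
-- the pairs (f a, f ā).  For each of the six clones C there is a preorder ≼ on signatures
-- (pair types, or the images, compared by inclusion, with some of the values at 𝟎 and 𝟏 kept
-- fixed) such that h = f(g₁,…,g_k) for some gᵢ ∈ C exactly when sig h ≼ sig f: the gᵢ are the
-- coordinates of a map choosing for every x a preimage of h x (for the self-dual clones, a
-- self-dual choice of preimages of the pairs (h x, h x̄)).  Deciding by excluded middle which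
-- signatures a clonoid reaches, the clonoids correspond to the down-sets of realizable
-- signatures, each of which is the signature of a ternary function.  What remains is a finite
-- comparison of these down-sets with the listed families; for S_c it is made separately inside
-- each of the four classes Ω_ab, which are then glued together.
module Submission where

open import Defs
open import Level using (0ℓ)
open import Axiom.ExcludedMiddle using (ExcludedMiddle)
open import Data.Bool using (Bool; true; false; not; _∧_; _∨_; if_then_else_; T; _≟_)
open import Data.Bool.Properties using (not-involutive; ¬-not; not-¬; T-∧; T-∨)
open import Data.Empty using (⊥-elim)
open import Data.Fin using (Fin)
import Data.Fin as Fin
open import Data.Fin.Patterns
open import Data.List using (List; []; _∷_; _++_; [_])
import Data.List as List
open import Data.List.Membership.Propositional using (_∈_; find; lose)
open import Data.List.Membership.Propositional.Properties
  using (∈-map⁺; ∈-++⁺ˡ; ∈-++⁺ʳ; ∈-allFin; ∈-cartesianProduct⁺)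
open import Data.List.Properties using (∷-injective)
open import Data.List.Relation.Unary.All as All using (All; []; _∷_)
open import Data.List.Relation.Unary.Any as Any using (here; there)
open import Data.Nat using (ℕ; zero; suc)
open import Data.Product using (_×_; Σ-syntax; ∃; ∃₂; ∃-syntax; _,_; proj₁; proj₂)
import Data.Product.Properties as Product
open import Data.Sum using (inj₁; inj₂)
open import Data.Unit using (tt)
open import Data.Vec using (Vec; []; _∷_; head; lookup; tabulate; replicate)
open import Data.Vec.Properties
  using (≡-dec; lookup∘tabulate; tabulate∘lookup; tabulate-cong; tabulate-∘; lookup-map; lookup-replicate;
         map-replicate; map-∘; map-cong; map-id)
open import Function using (_∘_; id)
open import Function.Bundles using (_⇔_; mk⇔; Equivalence)
open import Relation.Binary.Definitions using (DecidableEquality)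
open import Relation.Binary.PropositionalEquality
  using (_≡_; _≗_; refl; sym; trans; cong; cong₂; subst; subst₂; module ≡-Reasoning)
open import Relation.Nullary using (¬_; Dec; yes; no; does)
open import Relation.Nullary.Decidable
  using (⌊_⌋; map′; _×-dec_; _→-dec_; ¬?; T?; from-yes; toWitness; fromWitness)
open import Relation.Unary using (Pred; Decidable)

eval-tab : ∀ {n} (g : Vec Bool n → Bool) → eval (tab g) ≗ g
eval-tab {zero}  g []          = refl
eval-tab {suc n} g (false ∷ x) = eval-tab (g ∘ (false ∷_)) x
eval-tab {suc n} g (true ∷ x)  = eval-tab (g ∘ (true ∷_)) x

tab-eval : ∀ {n} (f : BF n) → tab (eval f) ≡ f
tab-eval {zero}  f         = refl
tab-eval {suc n} (f₀ , f₁) = cong₂ _,_ (tab-eval f₀) (tab-eval f₁)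

tab-cong : ∀ {n} {g g′ : Vec Bool n → Bool} → g ≗ g′ → tab g ≡ tab g′
tab-cong {zero}  g≗g′ = g≗g′ []
tab-cong {suc n} g≗g′ = cong₂ _,_ (tab-cong (g≗g′ ∘ (false ∷_))) (tab-cong (g≗g′ ∘ (true ∷_)))

eval-injective : ∀ {n} {f g : BF n} → eval f ≗ eval g → f ≡ g
eval-injective {f = f} {g} f≗g = trans (sym (tab-eval f)) (trans (tab-cong f≗g) (tab-eval g))

columns : ∀ {k m} → (Fin k → BF m) → Vec Bool m → Vec Bool k
columns g x = tabulate (λ i → eval (g i) x)

eval-comp : ∀ {k m} (f : BF k) (g : Fin k → BF m) x → eval (comp f g) x ≡ eval f (columns g x)
eval-comp f g = eval-tab _

coordinates : ∀ {k m} → (Vec Bool m → Vec Bool k) → Fin k → BF m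
coordinates Γ i = tab (λ x → lookup (Γ x) i)

eval-coordinates : ∀ {k m} (Γ : Vec Bool m → Vec Bool k) i x → eval (coordinates Γ i) x ≡ lookup (Γ x) i
eval-coordinates Γ i = eval-tab _

comp-coordinates : ∀ {k m} {f : BF k} {h : BF m} (Γ : Vec Bool m → Vec Bool k) →
  (∀ x → eval f (Γ x) ≡ eval h x) → comp f (coordinates Γ) ≡ h
comp-coordinates {f = f} {h} Γ fΓ≗h = eval-injective λ x → begin
  eval (comp f (coordinates Γ)) x     ≡⟨ eval-comp f (coordinates Γ) x ⟩
  eval f (columns (coordinates Γ) x)  ≡⟨ cong (eval f) (tabulate-cong (λ i → eval-coordinates Γ i x)) ⟩
  eval f (tabulate (lookup (Γ x)))    ≡⟨ cong (eval f) (tabulate∘lookup (Γ x)) ⟩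
  eval f (Γ x)                        ≡⟨ fΓ≗h x ⟩
  eval h x                            ∎
  where open ≡-Reasoning

neg-involutive : ∀ {n} (x : Vec Bool n) → neg (neg x) ≡ x
neg-involutive x = trans (sym (map-∘ not not x)) (trans (map-cong not-involutive x) (map-id x))

neg-𝟎 : ∀ {n} → neg (𝟎 {n}) ≡ 𝟏
neg-𝟎 = map-replicate not false _

inputs : ∀ n → List (Vec Bool n)
inputs zero    = [ [] ]
inputs (suc n) = List.map (false ∷_) (inputs n) ++ List.map (true ∷_) (inputs n)

∈-inputs : ∀ {n} (x : Vec Bool n) → x ∈ inputs n
∈-inputs []          = here refl
∈-inputs (false ∷ x) = ∈-++⁺ˡ (∈-map⁺ (false ∷_) (∈-inputs x))
∈-inputs (true ∷ x)  = ∈-++⁺ʳ (List.map (false ∷_) (inputs _)) (∈-map⁺ (true ∷_) (∈-inputs x))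

record Finite (A : Set) : Set where
  field
    elements   : List A
    ∈-elements : ∀ a → a ∈ elements
    _≡?_       : DecidableEquality A
open Finite using (elements; ∈-elements)

booleans : Finite Bool
booleans = record
  { elements   = false ∷ true ∷ []
  ; ∈-elements = λ { false → here refl ; true → there (here refl) }
  ; _≡?_       = _≟_
  }

vectors : ∀ n → Finite (Vec Bool n)
vectors n = record { elements = inputs n ; ∈-elements = ∈-inputs ; _≡?_ = ≡-dec _≟_ }

fins : ∀ n → Finite (Fin n)
fins n = record { elements = List.allFin n ; ∈-elements = ∈-allFin ; _≡?_ = Fin._≟_ }

_×ᶠ_ : ∀ {A B} → Finite A → Finite B → Finite (A × B)
𝒜 ×ᶠ ℬ = record
  { elements   = List.cartesianProduct (elements 𝒜) (elements ℬ)
  ; ∈-elements = λ (a , b) → ∈-cartesianProduct⁺ (∈-elements 𝒜 a) (∈-elements ℬ b)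
  ; _≡?_       = Product.≡-dec (Finite._≡?_ 𝒜) (Finite._≡?_ ℬ)
  }

∀? : ∀ {A : Set} {P : Pred A 0ℓ} → Finite A → Decidable P → Dec (∀ a → P a)
∀? 𝒜 P? = map′ (λ all a → All.lookup all (∈-elements 𝒜 a)) (λ p → All.tabulate (λ {a} _ → p a))
              (All.all? P? (elements 𝒜))

∃? : ∀ {A : Set} {P : Pred A 0ℓ} → Finite A → Decidable P → Dec (∃ P)
∃? 𝒜 P? = map′ (λ any → let (a , _ , Pa) = find any in a , Pa) (λ (a , Pa) → lose (∈-elements 𝒜 a) Pa)
              (Any.any? P? (elements 𝒜))

map-≡-∈ : ∀ {a b} {A : Set a} {B : Set b} {f g : A → B} {x xs} →
  List.map f xs ≡ List.map g xs → x ∈ xs → f x ≡ g x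
map-≡-∈ {xs = _ ∷ _} fxs≡gxs (here refl)  = proj₁ (∷-injective fxs≡gxs)
map-≡-∈ {xs = _ ∷ _} fxs≡gxs (there x∈xs) = map-≡-∈ (proj₂ (∷-injective fxs≡gxs)) x∈xs

≗-by-enumeration : ∀ {A : Set} {B : Set₁} (𝒜 : Finite A) (f g : A → B) →
  List.map f (elements 𝒜) ≡ List.map g (elements 𝒜) → ∀ a → f a ≡ g a
≗-by-enumeration 𝒜 f g fs≡gs a = map-≡-∈ fs≡gs (∈-elements 𝒜 a)

firstOr : ∀ {A : Set} {P : Pred A 0ℓ} → Decidable P → A → List A → A
firstOr P? d []       = d
firstOr P? d (x ∷ xs) = if does (P? x) then x else firstOr P? d xs

firstOr-satisfies : ∀ {A : Set} {P : Pred A 0ℓ} (P? : Decidable P) d {x xs} →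
  x ∈ xs → P x → P (firstOr P? d xs)
firstOr-satisfies P? d {xs = y ∷ ys} x∈ Px with P? y | x∈
... | yes Py | _          = Py
... | no ¬Py | here refl  = ⊥-elim (¬Py Px)
... | no ¬Py | there x∈ys = firstOr-satisfies P? d x∈ys Px

pick : ∀ {n} {P : Pred (Vec Bool n) 0ℓ} → Decidable P → Vec Bool n → Vec Bool n
pick P? c = firstOr P? c (c ∷ inputs _)

pick-satisfies : ∀ {n} {P : Pred (Vec Bool n) 0ℓ} (P? : Decidable P) c x → P x → P (pick P? c)
pick-satisfies P? c x = firstOr-satisfies P? c (there (∈-inputs x))

pick-preferred : ∀ {n} {P : Pred (Vec Bool n) 0ℓ} (P? : Decidable P) {c} → P c → pick P? c ≡ c
pick-preferred P? {c} Pc with P? c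
... | yes _  = refl
... | no ¬Pc = ⊥-elim (¬Pc Pc)

Occurs : ∀ {n} → BF n → Bool → Bool → Set
Occurs f u v = ∃ λ a → eval f a ≡ u × eval f (neg a) ≡ v

occurs? : ∀ {n} (f : BF n) u v → Dec (Occurs f u v)
occurs? f u v = ∃? (vectors _) (λ a → (eval f a ≟ u) ×-dec (eval f (neg a) ≟ v))

Occurs-swap : ∀ {n} {f : BF n} {u v} → Occurs f u v → Occurs f v u
Occurs-swap {f = f} (a , fa≡u , fā≡v) = neg a , fā≡v , trans (cong (eval f) (neg-involutive a)) fa≡u

Image : ∀ {n} → BF n → Bool → Set
Image f u = ∃ λ a → eval f a ≡ u

Sig : Set
Sig = Vec Bool 5

sigOf : ∀ {n} → BF n → Sig
sigOf f = eval f 𝟎 ∷ eval f 𝟏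
  ∷ ⌊ occurs? f false false ⌋ ∷ ⌊ occurs? f true true ⌋ ∷ ⌊ occurs? f false true ⌋ ∷ []

at𝟎 at𝟏 : Sig → Bool
at𝟎 s = lookup s 0F
at𝟏 s = lookup s 1F

pairIndex : Bool → Bool → Fin 5
pairIndex false false = 2F
pairIndex true  true  = 3F
pairIndex _     _     = 4F

pair : Bool → Bool → Sig → Bool
pair u v s = lookup s (pairIndex u v)

value : Bool → Sig → Bool
value u s = pair u false s ∨ pair u true s

realizable : Sig → Bool
realizable s = pair (at𝟎 s) (at𝟏 s) s

pair-sigOf : ∀ {n} (f : BF n) u v → T (pair u v (sigOf f)) ⇔ Occurs f u v
pair-sigOf f false false = mk⇔ toWitness fromWitness
pair-sigOf f true  true  = mk⇔ toWitness fromWitness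
pair-sigOf f false true  = mk⇔ toWitness fromWitness
pair-sigOf f true  false = mk⇔ (Occurs-swap ∘ toWitness) (fromWitness ∘ Occurs-swap)

value-sigOf : ∀ {n} (f : BF n) u → T (value u (sigOf f)) ⇔ Image f u
value-sigOf f u = mk⇔ to from
  where
  to : T (value u (sigOf f)) → Image f u
  to p with Equivalence.to T-∨ p
  ... | inj₁ p₀ = let (a , fa≡u , _) = Equivalence.to (pair-sigOf f u false) p₀ in a , fa≡u
  ... | inj₂ p₁ = let (a , fa≡u , _) = Equivalence.to (pair-sigOf f u true) p₁ in a , fa≡u
  from : Image f u → T (value u (sigOf f))
  from (a , fa≡u) with eval f (neg a) in fā≡v
  ... | false = Equivalence.from T-∨ (inj₁ (Equivalence.from (pair-sigOf f u false) (a , fa≡u , fā≡v)))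
  ... | true  = Equivalence.from T-∨ (inj₂ (Equivalence.from (pair-sigOf f u true) (a , fa≡u , fā≡v)))

realizable-sigOf : ∀ {n} (f : BF n) → T (realizable (sigOf f))
realizable-sigOf f = Equivalence.from (pair-sigOf f _ _) (𝟎 , refl , cong (eval f) neg-𝟎)

-- The antipodal pair {000, 111} carries (f 𝟎, f 𝟏); each of the other three antipodal pairs
-- carries one of the pair types {0,0}, {1,1}, {0,1} if the signature asks for it, and
-- repeats (f 𝟎, f 𝟏) otherwise.
antipodalValues : Sig → Bool → Bool → Bool × Bool
antipodalValues (a ∷ b ∷ _ ∷ _ ∷ _ ∷ []) false false = a , b
antipodalValues (a ∷ b ∷ p ∷ _ ∷ _ ∷ []) false true  = if p then (false , false) else (a , b)
antipodalValues (a ∷ b ∷ _ ∷ p ∷ _ ∷ []) true  false = if p then (true , true) else (a , b)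
antipodalValues (a ∷ b ∷ _ ∷ _ ∷ p ∷ []) true  true  = if p then (false , true) else (a , b)

witnessTable : Sig → Vec Bool 3 → Bool
witnessTable s (false ∷ y ∷ z ∷ []) = proj₁ (antipodalValues s y z)
witnessTable s (true ∷ y ∷ z ∷ [])  = proj₂ (antipodalValues s (not y) (not z))

witness : Sig → BF 3
witness s = tab (witnessTable s)

sigOf-witness : ∀ s → T (realizable s) → sigOf (witness s) ≡ s
sigOf-witness = from-yes (∀? (vectors 5) λ s → T? (realizable s) →-dec ≡-dec _≟_ (sigOf (witness s)) s)

≐-sym : ∀ {K L} → K ≐ L → L ≐ K
≐-sym (K⊆L , L⊆K) = L⊆K , K⊆L

≐-trans : ∀ {K L M} → K ≐ L → L ≐ M → K ≐ M
≐-trans (K⊆L , L⊆K) (L⊆M , M⊆L) = (λ n f → L⊆M n f ∘ K⊆L n f) , (λ n f → L⊆K n f ∘ M⊆L n f)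

∃≐-resp : ∀ {Idx : Set} {U V : Idx → BSet} {K} → (∀ i → U i ≡ V i) → ∃[ i ] (K ≐ U i) → ∃[ i ] (K ≐ V i)
∃≐-resp {K = K} U≡V (i , K≐Uᵢ) = i , subst (K ≐_) (U≡V i) K≐Uᵢ

Classification-resp : ∀ {C₁ C₂ Idx} {U V : Idx → BSet} → (∀ i → U i ≡ V i) →
  Classification C₁ C₂ Idx U → Classification C₁ C₂ Idx V
Classification-resp {C₁} {C₂} U≡V (clonoids , complete , injective) =
  (λ i → subst (IsClonoid C₁ C₂) (U≡V i) (clonoids i)) ,
  (λ K K-clonoid → ∃≐-resp U≡V (complete K K-clonoid)) ,
  (λ i j Vᵢ≐Vⱼ → injective i j (subst₂ _≐_ (sym (U≡V i)) (sym (U≡V j)) Vᵢ≐Vⱼ))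

T-extensional : ∀ {a b} → (T a → T b) → (T b → T a) → a ≡ b
T-extensional {false} {false} _   _   = refl
T-extensional {false} {true}  _   b⇒a = ⊥-elim (b⇒a tt)
T-extensional {true}  {false} a⇒b _   = ⊥-elim (a⇒b tt)
T-extensional {true}  {true}  _   _   = refl

SigSet : (Sig → Bool) → BSet
SigSet P n f = T (P (sigOf f))

_≗ʳ_ : (Sig → Bool) → (Sig → Bool) → Set
P ≗ʳ Q = ∀ s → T (realizable s) → P s ≡ Q s

SigSet-cong : ∀ {P Q} → P ≗ʳ Q → SigSet P ≐ SigSet Q
SigSet-cong P≗Q = (λ n f → subst T (P≗Q _ (realizable-sigOf f)))
                , (λ n f → subst T (sym (P≗Q _ (realizable-sigOf f))))

SigSet-injective : ∀ {P Q} → SigSet P ≐ SigSet Q → P ≗ʳ Q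
SigSet-injective {P} {Q} (P⊆Q , Q⊆P) s s-real = T-extensional (through {P} {Q} P⊆Q) (through {Q} {P} Q⊆P)
  where
  through : ∀ {P Q} → SigSet P ⊆ SigSet Q → T (P s) → T (Q s)
  through {P} {Q} P⊆Q Ps = subst (T ∘ Q) (sigOf-witness s s-real)
    (P⊆Q _ (witness s) (subst (T ∘ P) (sym (sigOf-witness s s-real)) Ps))

∪-sig : ∀ {K L P Q} → K ≐ SigSet P → L ≐ SigSet Q → (K ∪ L) ≐ SigSet (λ s → P s ∨ Q s)
∪-sig {K} {L} {P} {Q} (K⊆P , P⊆K) (L⊆Q , Q⊆L) = to , from
  where
  to : (K ∪ L) ⊆ SigSet (λ s → P s ∨ Q s)
  to n f (inj₁ x) = Equivalence.from T-∨ (inj₁ (K⊆P n f x))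
  to n f (inj₂ y) = Equivalence.from T-∨ (inj₂ (L⊆Q n f y))
  from : SigSet (λ s → P s ∨ Q s) ⊆ (K ∪ L)
  from n f p with Equivalence.to T-∨ p
  ... | inj₁ x = inj₁ (P⊆K n f x)
  ... | inj₂ y = inj₂ (Q⊆L n f y)

∩-sig : ∀ {K L P Q} → K ≐ SigSet P → L ≐ SigSet Q → (K ∩ L) ≐ SigSet (λ s → P s ∧ Q s)
∩-sig (K⊆P , P⊆K) (L⊆Q , Q⊆L) =
  (λ n f (x , y) → Equivalence.from T-∧ (K⊆P n f x , L⊆Q n f y)) ,
  (λ n f p → let (x , y) = Equivalence.to T-∧ p in P⊆K n f x , Q⊆L n f y)

Pairwise : (Bool → Bool → Set) → BSet
Pairwise R n f = ∀ a → R (eval f a) (eval f (neg a))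

Admits : (Bool → Bool → Set) → Sig → Set
Admits R s = ∀ u v → T (pair u v s) → R u v

admits? : ∀ {R} → (∀ u v → Dec (R u v)) → ∀ s → Dec (Admits R s)
admits? R? s = ∀? booleans λ u → ∀? booleans λ v → T? (pair u v s) →-dec R? u v

Pairwise-sig : ∀ {R} (R? : ∀ u v → Dec (R u v)) → Pairwise R ≐ SigSet (λ s → ⌊ admits? R? s ⌋)
Pairwise-sig {R} R? = to , from
  where
  to : Pairwise R ⊆ SigSet (λ s → ⌊ admits? R? s ⌋)
  to n f Rf = fromWitness {a? = admits? R? (sigOf f)} λ u v uv∈f →
    let (a , fa≡u , fā≡v) = Equivalence.to (pair-sigOf f u v) uv∈f in subst₂ R fa≡u fā≡v (Rf a)
  from : SigSet (λ s → ⌊ admits? R? s ⌋) ⊆ Pairwise R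
  from n f adm a = toWitness {a? = admits? R? (sigOf f)} adm _ _
    (Equivalence.from (pair-sigOf f _ _) (a , refl , refl))

data SetExpr : Set₁ where
  ∅ᵉ Ωᵉ     : SetExpr
  pairwiseᵉ : (R : Bool → Bool → Set) → (∀ u v → Dec (R u v)) → SetExpr
  Ωa*ᵉ Ω*bᵉ : Bool → SetExpr
  _∪ᵉ_ _∩ᵉ_ : SetExpr → SetExpr → SetExpr

infixr 6 _∪ᵉ_
infixr 7 _∩ᵉ_

⟦_⟧ : SetExpr → BSet
⟦ ∅ᵉ ⟧            = ∅
⟦ Ωᵉ ⟧            = Ω
⟦ pairwiseᵉ R _ ⟧ = Pairwise R
⟦ Ωa*ᵉ x ⟧        = Ωa* x
⟦ Ω*bᵉ y ⟧        = Ω*b y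
⟦ e ∪ᵉ e′ ⟧       = ⟦ e ⟧ ∪ ⟦ e′ ⟧
⟦ e ∩ᵉ e′ ⟧       = ⟦ e ⟧ ∩ ⟦ e′ ⟧

⟦_⟧ˢ : SetExpr → Sig → Bool
⟦ ∅ᵉ ⟧ˢ s             = false
⟦ Ωᵉ ⟧ˢ s             = true
⟦ pairwiseᵉ _ R? ⟧ˢ s = ⌊ admits? R? s ⌋
⟦ Ωa*ᵉ x ⟧ˢ s         = ⌊ at𝟎 s ≟ x ⌋
⟦ Ω*bᵉ y ⟧ˢ s         = ⌊ at𝟏 s ≟ y ⌋
⟦ e ∪ᵉ e′ ⟧ˢ s        = ⟦ e ⟧ˢ s ∨ ⟦ e′ ⟧ˢ s
⟦ e ∩ᵉ e′ ⟧ˢ s        = ⟦ e ⟧ˢ s ∧ ⟦ e′ ⟧ˢ s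

⟦⟧-sig : ∀ e → ⟦ e ⟧ ≐ SigSet ⟦ e ⟧ˢ
⟦⟧-sig ∅ᵉ               = (λ _ _ ()) , (λ _ _ ())
⟦⟧-sig Ωᵉ               = (λ _ _ _ → tt) , (λ _ _ _ → tt)
⟦⟧-sig (pairwiseᵉ _ R?) = Pairwise-sig R?
⟦⟧-sig (Ωa*ᵉ x)         = (λ _ f → fromWitness {a? = eval f 𝟎 ≟ x}) ,
                          (λ _ f → toWitness {a? = eval f 𝟎 ≟ x})
⟦⟧-sig (Ω*bᵉ y)         = (λ _ f → fromWitness {a? = eval f 𝟏 ≟ y}) ,
                          (λ _ f → toWitness {a? = eval f 𝟏 ≟ y})
⟦⟧-sig (e ∪ᵉ e′)        = ∪-sig {P = ⟦ e ⟧ˢ} {Q = ⟦ e′ ⟧ˢ} (⟦⟧-sig e) (⟦⟧-sig e′)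
⟦⟧-sig (e ∩ᵉ e′)        = ∩-sig {P = ⟦ e ⟧ˢ} {Q = ⟦ e′ ⟧ˢ} (⟦⟧-sig e) (⟦⟧-sig e′)

C₀ᵉ C₁ᵉ Cᵉ Sᵉ Reflᵉ Sminᵉ Smajᵉ : SetExpr
C₀ᵉ   = pairwiseᵉ (λ u _ → u ≡ false) (λ u _ → u ≟ false)
C₁ᵉ   = pairwiseᵉ (λ u _ → u ≡ true) (λ u _ → u ≟ true)
Cᵉ    = C₀ᵉ ∪ᵉ C₁ᵉ
Sᵉ    = pairwiseᵉ (λ u v → ¬ v ≡ u) (λ u v → ¬? (v ≟ u))
Reflᵉ = pairwiseᵉ (λ u v → v ≡ u) (λ u v → v ≟ u)
Sminᵉ = pairwiseᵉ (λ u v → u ∧ v ≡ false) (λ u v → u ∧ v ≟ false)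
Smajᵉ = pairwiseᵉ (λ u v → u ∨ v ≡ true) (λ u v → u ∨ v ≟ true)

Ωabᵉ : Bool → Bool → SetExpr
Ωabᵉ x y = Ωa*ᵉ x ∩ᵉ Ω*bᵉ y

RClosed : BSet → BSet → Set
RClosed C K = CompIn K C K

Ic-absorbed : ∀ K → CompIn Ic K K
Ic-absorbed K k m f g (i , f≗proj) g∈K = subst (K m) (sym comp≡gᵢ) (g∈K i)
  where
  comp≡gᵢ : comp f g ≡ g i
  comp≡gᵢ = eval-injective λ x →
    trans (eval-comp f g x) (trans (f≗proj (columns g x)) (lookup∘tabulate (λ j → eval (g j) x) i))

RClosed-≐ : ∀ {C K L} → K ≐ L → RClosed C K → RClosed C L
RClosed-≐ (K⊆L , L⊆K) rc k m f g fL g∈C = K⊆L m _ (rc k m f g (L⊆K k f fL) g∈C)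

RClosed-∩ : ∀ {C K L} → RClosed C K → RClosed C L → RClosed C (K ∩ L)
RClosed-∩ rcK rcL k m f g (fK , fL) g∈C = rcK k m f g fK g∈C , rcL k m f g fL g∈C

factor : ∀ {C K k m} {f : BF (suc k)} {h : BF (suc m)} (Γ : Vec Bool (suc m) → Vec Bool (suc k)) →
  RClosed C K → K k f → (∀ i → C m (coordinates Γ i)) → (∀ x → eval f (Γ x) ≡ eval h x) → K m h
factor {K = K} Γ rc fK Γ∈C fΓ≗h = subst (K _) (comp-coordinates Γ fΓ≗h) (rc _ _ _ _ fK Γ∈C)

coordinates-S : ∀ {k m} (Γ : Vec Bool (suc m) → Vec Bool k) → (∀ x → Γ (neg x) ≡ neg (Γ x)) →
  ∀ i → S m (coordinates Γ i)
coordinates-S Γ Γ-neg i a p = not-¬ refl (trans (sym p) negated)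
  where
  open ≡-Reasoning
  negated : eval (coordinates Γ i) (neg a) ≡ not (eval (coordinates Γ i) a)
  negated = begin
    eval (coordinates Γ i) (neg a)  ≡⟨ eval-coordinates Γ i (neg a) ⟩
    lookup (Γ (neg a)) i            ≡⟨ cong (λ y → lookup y i) (Γ-neg a) ⟩
    lookup (neg (Γ a)) i            ≡⟨ lookup-map i not (Γ a) ⟩
    not (lookup (Γ a) i)            ≡⟨ cong not (sym (eval-coordinates Γ i a)) ⟩
    not (eval (coordinates Γ i) a)  ∎

coordinates-const : ∀ {k m} (Γ : Vec Bool m → Vec Bool k) x {b} → Γ x ≡ replicate k b →
  ∀ i → eval (coordinates Γ i) x ≡ b
coordinates-const Γ x {b} Γx≡b i =
  trans (eval-coordinates Γ i x) (trans (cong (λ y → lookup y i) Γx≡b) (lookup-replicate i b))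

columns-const : ∀ {k m} (g : Fin k → BF m) {x b} → (∀ i → eval (g i) x ≡ b) → columns g x ≡ replicate k b
columns-const g {b = b} gᵢx≡b =
  trans (tabulate-cong (λ i → trans (gᵢx≡b i) (sym (lookup-replicate i b)))) (tabulate∘lookup _)

columns-neg : ∀ {k m} (g : Fin k → BF (suc m)) → (∀ i → S m (g i)) →
  ∀ x → columns g (neg x) ≡ neg (columns g x)
columns-neg g g∈S x = trans (tabulate-cong (λ i → ¬-not (g∈S i x))) (tabulate-∘ not _)

comp-const : ∀ {k m} (f : BF k) (g : Fin k → BF m) x {b} → (∀ i → eval (g i) x ≡ b) →
  eval (comp f g) x ≡ eval f (replicate k b)
comp-const f g x gᵢx≡b = trans (eval-comp f g x) (cong (eval f) (columns-const g gᵢx≡b))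

comp-Occurs : ∀ {k m} (f : BF k) (g : Fin k → BF (suc m)) → (∀ i → S m (g i)) →
  ∀ {u v} → Occurs (comp f g) u v → Occurs f u v
comp-Occurs f g g∈S (a , fga≡u , fgā≡v) =
  columns g a , trans (sym (eval-comp f g a)) fga≡u ,
  trans (cong (eval f) (sym (columns-neg g g∈S a))) (trans (sym (eval-comp f g (neg a))) fgā≡v)

comp-Image : ∀ {k m} (f : BF k) (g : Fin k → BF m) → ∀ {u} → Image (comp f g) u → Image f u
comp-Image f g (a , fga≡u) = columns g a , trans (sym (eval-comp f g a)) fga≡u

module SelfDualFactorization {k m} (f : BF (suc k)) (h : BF (suc m)) where

  realizes? : ∀ u v c → Dec (eval f c ≡ u × eval f (neg c) ≡ v)
  realizes? u v c = (eval f c ≟ u) ×-dec (eval f (neg c) ≟ v)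

  realizing : Bool → Bool → Vec Bool (suc k)
  realizing u v = pick (realizes? u v) 𝟎

  realizing-realizes : ∀ {u v} → Occurs f u v →
    eval f (realizing u v) ≡ u × eval f (neg (realizing u v)) ≡ v
  realizing-realizes {u} {v} (c , fc≡u,fc̄≡v) = pick-satisfies (realizes? u v) 𝟎 c fc≡u,fc̄≡v

  Γ : Vec Bool (suc m) → Vec Bool (suc k)
  Γ (false ∷ x) = realizing (eval h (false ∷ x)) (eval h (true ∷ neg x))
  Γ (true ∷ x)  = neg (realizing (eval h (false ∷ neg x)) (eval h (true ∷ x)))

  Γ-neg : ∀ x → Γ (neg x) ≡ neg (Γ x)
  Γ-neg (false ∷ x) =
    cong (λ y → neg (realizing (eval h (false ∷ y)) (eval h (true ∷ neg x)))) (neg-involutive x)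
  Γ-neg (true ∷ x)  = trans
    (cong (λ y → realizing (eval h (false ∷ neg x)) (eval h (true ∷ y))) (neg-involutive x))
    (sym (neg-involutive _))

  Γ-factors : (∀ u v → Occurs h u v → Occurs f u v) → ∀ x → eval f (Γ x) ≡ eval h x
  Γ-factors occ (false ∷ x) = proj₁ (realizing-realizes (occ _ _ (false ∷ x , refl , refl)))
  Γ-factors occ (true ∷ x)  = proj₂ (realizing-realizes
    (occ _ _ (false ∷ neg x , refl , cong (λ y → eval h (true ∷ y)) (neg-involutive x))))

  Γ-𝟎 : eval f 𝟎 ≡ eval h 𝟎 → eval f 𝟏 ≡ eval h 𝟏 → Γ 𝟎 ≡ 𝟎
  Γ-𝟎 f𝟎≡h𝟎 f𝟏≡h𝟏 = pick-preferred (realizes? _ _)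
    (f𝟎≡h𝟎 , trans (cong (eval f) neg-𝟎) (trans f𝟏≡h𝟏 (cong (λ y → eval h (true ∷ y)) (sym neg-𝟎))))

  Γ-𝟏 : eval f 𝟎 ≡ eval h 𝟎 → eval f 𝟏 ≡ eval h 𝟏 → Γ 𝟏 ≡ 𝟏
  Γ-𝟏 f𝟎≡h𝟎 f𝟏≡h𝟏 =
    trans (cong Γ (sym neg-𝟎)) (trans (Γ-neg 𝟎) (trans (cong neg (Γ-𝟎 f𝟎≡h𝟎 f𝟏≡h𝟏)) neg-𝟎))

module ImageFactorization {k m} (f : BF (suc k)) (h : BF (suc m)) where

  hits? : ∀ x c → Dec (eval f c ≡ eval h x)
  hits? x c = eval f c ≟ eval h x

  -- the preferred preimage of h x is 𝟎 at x = 𝟎 and 𝟏 at x = 𝟏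
  Γ : Vec Bool (suc m) → Vec Bool (suc k)
  Γ x = pick (hits? x) (replicate _ (head x))

  Γ-factors : (∀ u → Image h u → Image f u) → ∀ x → eval f (Γ x) ≡ eval h x
  Γ-factors im x =
    let (c , fc≡hx) = im _ (x , refl) in pick-satisfies (hits? x) (replicate _ (head x)) c fc≡hx

  Γ-𝟎 : eval f 𝟎 ≡ eval h 𝟎 → Γ 𝟎 ≡ 𝟎
  Γ-𝟎 = pick-preferred (hits? 𝟎)

  Γ-𝟏 : eval f 𝟏 ≡ eval h 𝟏 → Γ 𝟏 ≡ 𝟏
  Γ-𝟏 = pick-preferred (hits? 𝟏)

Observable : Set
Observable = Sig → Bool

_⊑[_]_ : Sig → List Observable → Sig → Set
s ⊑[ os ] t = All (λ o → T (o s) → T (o t)) os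

_≼[_,_]_ : Sig → List Observable → List Observable → Sig → Set
s ≼[ kept , monotone ] t = All (λ o → o s ≡ o t) kept × s ⊑[ monotone ] t

ends pairs values : List Observable
ends   = at𝟎 ∷ at𝟏 ∷ []
pairs  = pair false false ∷ pair true true ∷ pair false true ∷ []
values = value false ∷ value true ∷ []

sigOf-⊑-pairs : ∀ {k m} {f : BF k} {h : BF m} →
  sigOf h ⊑[ pairs ] sigOf f ⇔ (∀ u v → Occurs h u v → Occurs f u v)
sigOf-⊑-pairs {f = f} {h} = mk⇔ to from
  where
  pair-mono : ∀ {s t} → s ⊑[ pairs ] t → ∀ u v → T (pair u v s) → T (pair u v t)
  pair-mono (p ∷ _ ∷ _ ∷ []) false false = p
  pair-mono (_ ∷ p ∷ _ ∷ []) true  true  = p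
  pair-mono (_ ∷ _ ∷ p ∷ []) false true  = p
  pair-mono (_ ∷ _ ∷ p ∷ []) true  false = p
  to : sigOf h ⊑[ pairs ] sigOf f → ∀ u v → Occurs h u v → Occurs f u v
  to ps u v = Equivalence.to (pair-sigOf f u v) ∘ pair-mono ps u v ∘ Equivalence.from (pair-sigOf h u v)
  from : (∀ u v → Occurs h u v → Occurs f u v) → sigOf h ⊑[ pairs ] sigOf f
  from occ = through false false ∷ through true true ∷ through false true ∷ []
    where
    through : ∀ u v → T (pair u v (sigOf h)) → T (pair u v (sigOf f))
    through u v = Equivalence.from (pair-sigOf f u v) ∘ occ u v ∘ Equivalence.to (pair-sigOf h u v)

sigOf-⊑-values : ∀ {k m} {f : BF k} {h : BF m} →
  sigOf h ⊑[ values ] sigOf f ⇔ (∀ u → Image h u → Image f u)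
sigOf-⊑-values {f = f} {h} = mk⇔ to from
  where
  to : sigOf h ⊑[ values ] sigOf f → ∀ u → Image h u → Image f u
  to (v₀ ∷ _ ∷ []) false =
    Equivalence.to (value-sigOf f false) ∘ v₀ ∘ Equivalence.from (value-sigOf h false)
  to (_ ∷ v₁ ∷ []) true  =
    Equivalence.to (value-sigOf f true) ∘ v₁ ∘ Equivalence.from (value-sigOf h true)
  from : (∀ u → Image h u → Image f u) → sigOf h ⊑[ values ] sigOf f
  from im = through false ∷ through true ∷ []
    where
    through : ∀ u → T (value u (sigOf h)) → T (value u (sigOf f))
    through u = Equivalence.from (value-sigOf f u) ∘ im u ∘ Equivalence.to (value-sigOf h u)

comp-⊑-pairs : ∀ {k m} (f : BF k) (g : Fin k → BF (suc m)) → (∀ i → S m (g i)) →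
  sigOf (comp f g) ⊑[ pairs ] sigOf f
comp-⊑-pairs f g g∈S = Equivalence.from sigOf-⊑-pairs (λ _ _ → comp-Occurs f g g∈S)

comp-⊑-values : ∀ {k m} (f : BF k) (g : Fin k → BF m) → sigOf (comp f g) ⊑[ values ] sigOf f
comp-⊑-values f g = Equivalence.from sigOf-⊑-values (λ _ → comp-Image f g)

Generates : BSet → List Observable → List Observable → Set₁
Generates C kept monotone = ∀ {K} → RClosed C K → ∀ {k m} {f : BF (suc k)} {h : BF (suc m)} →
  K k f → sigOf h ≼[ kept , monotone ] sigOf f → K m h
Shrinks : BSet → List Observable → List Observable → Set
Shrinks C kept monotone = ∀ {k m} (f : BF (suc k)) (g : Fin (suc k) → BF (suc m)) →
  (∀ i → C m (g i)) → sigOf (comp f g) ≼[ kept , monotone ] sigOf f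

-- Together, generates and shrinks say that h lies in every C-closed set containing f
-- if and only if sigOf h ≼ sigOf f.
record SignatureOrder (C : BSet) : Set₁ where
  field
    kept monotone : List Observable
    generates     : Generates C kept monotone
    shrinks       : Shrinks C kept monotone

Sc-order : SignatureOrder Sc
Sc-order = record { kept = ends ; monotone = pairs ; generates = generates ; shrinks = shrinks }
  where
  generates : Generates Sc ends pairs
  generates rc {f = f} {h} fK (h𝟎≡f𝟎 ∷ h𝟏≡f𝟏 ∷ [] , ps) =
    factor {C = Sc} Γ rc fK
      (λ i → coordinates-S Γ Γ-neg i , coordinates-const Γ 𝟎 Γ𝟎≡𝟎 i , coordinates-const Γ 𝟏 Γ𝟏≡𝟏 i)
      (Γ-factors (Equivalence.to sigOf-⊑-pairs ps))
    where
    open SelfDualFactorization f h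
    Γ𝟎≡𝟎 = Γ-𝟎 (sym h𝟎≡f𝟎) (sym h𝟏≡f𝟏)
    Γ𝟏≡𝟏 = Γ-𝟏 (sym h𝟎≡f𝟎) (sym h𝟏≡f𝟏)
  shrinks : Shrinks Sc ends pairs
  shrinks f g g∈Sc =
    (comp-const f g 𝟎 (proj₁ ∘ proj₂ ∘ g∈Sc) ∷ comp-const f g 𝟏 (proj₂ ∘ proj₂ ∘ g∈Sc) ∷ []) ,
    comp-⊑-pairs f g (proj₁ ∘ g∈Sc)

S-order : SignatureOrder S
S-order = record { kept = [] ; monotone = pairs ; generates = generates ; shrinks = shrinks }
  where
  generates : Generates S [] pairs
  generates rc {f = f} {h} fK ([] , ps) =
    factor {C = S} Γ rc fK (coordinates-S Γ Γ-neg) (Γ-factors (Equivalence.to sigOf-⊑-pairs ps))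
    where open SelfDualFactorization f h
  shrinks : Shrinks S [] pairs
  shrinks f g g∈S = [] , comp-⊑-pairs f g g∈S

Ω01-order : SignatureOrder (Ωab false true)
Ω01-order = record { kept = ends ; monotone = values ; generates = generates ; shrinks = shrinks }
  where
  generates : Generates (Ωab false true) ends values
  generates rc {f = f} {h} fK (h𝟎≡f𝟎 ∷ h𝟏≡f𝟏 ∷ [] , vs) =
    factor {C = Ωab false true} Γ rc fK
      (λ i → coordinates-const Γ 𝟎 (Γ-𝟎 (sym h𝟎≡f𝟎)) i , coordinates-const Γ 𝟏 (Γ-𝟏 (sym h𝟏≡f𝟏)) i)
      (Γ-factors (Equivalence.to sigOf-⊑-values vs))
    where open ImageFactorization f h
  shrinks : Shrinks (Ωab false true) ends values
  shrinks f g g∈Ω01 =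
    (comp-const f g 𝟎 (proj₁ ∘ g∈Ω01) ∷ comp-const f g 𝟏 (proj₂ ∘ g∈Ω01) ∷ []) , comp-⊑-values f g

Ω0*-order : SignatureOrder (Ωa* false)
Ω0*-order = record { kept = at𝟎 ∷ [] ; monotone = values ; generates = generates ; shrinks = shrinks }
  where
  generates : Generates (Ωa* false) (at𝟎 ∷ []) values
  generates rc {f = f} {h} fK (h𝟎≡f𝟎 ∷ [] , vs) =
    factor {C = Ωa* false} Γ rc fK (coordinates-const Γ 𝟎 (Γ-𝟎 (sym h𝟎≡f𝟎)))
      (Γ-factors (Equivalence.to sigOf-⊑-values vs))
    where open ImageFactorization f h
  shrinks : Shrinks (Ωa* false) (at𝟎 ∷ []) values
  shrinks f g g∈Ω0* = (comp-const f g 𝟎 g∈Ω0* ∷ []) , comp-⊑-values f g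

Ω*1-order : SignatureOrder (Ω*b true)
Ω*1-order = record { kept = at𝟏 ∷ [] ; monotone = values ; generates = generates ; shrinks = shrinks }
  where
  generates : Generates (Ω*b true) (at𝟏 ∷ []) values
  generates rc {f = f} {h} fK (h𝟏≡f𝟏 ∷ [] , vs) =
    factor {C = Ω*b true} Γ rc fK (coordinates-const Γ 𝟏 (Γ-𝟏 (sym h𝟏≡f𝟏)))
      (Γ-factors (Equivalence.to sigOf-⊑-values vs))
    where open ImageFactorization f h
  shrinks : Shrinks (Ω*b true) (at𝟏 ∷ []) values
  shrinks f g g∈Ω*1 = (comp-const f g 𝟏 g∈Ω*1 ∷ []) , comp-⊑-values f g

Ω-order : SignatureOrder Ω
Ω-order = record { kept = [] ; monotone = values ; generates = generates ; shrinks = shrinks }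
  where
  generates : Generates Ω [] values
  generates rc {f = f} {h} fK ([] , vs) =
    factor {C = Ω} Γ rc fK (λ _ → tt) (Γ-factors (Equivalence.to sigOf-⊑-values vs))
    where open ImageFactorization f h
  shrinks : Shrinks Ω [] values
  shrinks f g _ = [] , comp-⊑-values f g

module Classify {C : BSet} (order : SignatureOrder C) where
  open SignatureOrder order

  _≼_ : Sig → Sig → Set
  s ≼ t = s ≼[ kept , monotone ] t

  _≼?_ : ∀ s t → Dec (s ≼ t)
  s ≼? t = All.all? (λ o → o s ≟ o t) kept ×-dec All.all? (λ o → T? (o s) →-dec T? (o t)) monotone

  ≼-refl : ∀ {s} → s ≼ s
  ≼-refl = All.tabulate (λ _ → refl) , All.tabulate (λ _ → id)

  ≼-trans : ∀ {s t u} → s ≼ t → t ≼ u → s ≼ u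
  ≼-trans (e , m) (e′ , m′) =
    All.zipWith (λ (p , q) → trans p q) (e , e′) , All.zipWith (λ (p , q) → q ∘ p) (m , m′)

  signatures : Finite Sig
  signatures = vectors 5

  DownClosed : (Sig → Bool) → Set
  DownClosed P = ∀ s t → T (realizable s) → T (realizable t) → s ≼ t → T (P t) → T (P s)

  downClosed? : ∀ P → Dec (DownClosed P)
  downClosed? P = ∀? signatures λ s → ∀? signatures λ t →
    T? (realizable s) →-dec T? (realizable t) →-dec s ≼? t →-dec T? (P t) →-dec T? (P s)

  downClosed-≈ : ∀ {P s t} → DownClosed P → T (realizable s) → T (realizable t) → s ≼ t → t ≼ s → P s ≡ P t
  downClosed-≈ dc rs rt s≼t t≼s = T-extensional (dc _ _ rt rs t≼s) (dc _ _ rs rt s≼t)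

  SigSet-closed : ∀ {P} → DownClosed P → RClosed C (SigSet P)
  SigSet-closed dc k m f g Pf g∈C =
    dc _ _ (realizable-sigOf (comp f g)) (realizable-sigOf f) (shrinks f g g∈C) Pf

  module _ (lem : ExcludedMiddle 0ℓ) where

    Below : BSet → Sig → Set
    Below K s = Σ[ n ∈ ℕ ] Σ[ f ∈ BF (suc n) ] K n f × s ≼ sigOf f

    below : BSet → Sig → Bool
    below K s = ⌊ lem {Below K s} ⌋

    below-downClosed : ∀ K → DownClosed (below K)
    below-downClosed K s t _ _ s≼t Bt =
      let (n , f , fK , t≼f) = toWitness {a? = lem {Below K t}} Bt
      in fromWitness {a? = lem {Below K s}} (n , f , fK , ≼-trans s≼t t≼f)

    closed-≐-below : ∀ {K} → RClosed C K → K ≐ SigSet (below K)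
    closed-≐-below {K} rc =
      (λ n f fK → fromWitness {a? = lem {Below K (sigOf f)}} (n , f , fK , ≼-refl)) ,
      (λ m h Bh → let (n , f , fK , h≼f) = toWitness {a? = lem {Below K (sigOf h)}} Bh
                  in generates rc fK h≼f)

  -- The representatives are a parameter rather than a local definition so that they are
  -- computed only once while a certificate is being checked.
  module Catalogue (W : SetExpr) {Idx : Set} (indices : Finite Idx) (E : Idx → SetExpr)
                   (representatives : List Sig) where

    R : ℕ
    R = List.length representatives

    rep : Fin R → Sig
    rep = List.lookup representatives

    profile : (Sig → Bool) → Vec Bool R
    profile P = tabulate (P ∘ rep)

    Within : (Sig → Bool) → Set
    Within P = ∀ s → T (realizable s) → T (P s) → T (⟦ W ⟧ˢ s)

    DownClosedProfile : Vec Bool R → Set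
    DownClosedProfile v = ∀ j j′ → rep j ≼ rep j′ → T (lookup v j′) → T (lookup v j)

    record Certificate : Set where
      constructor certificate
      field
        window-downClosed  : DownClosed ⟦ W ⟧ˢ
        members-downClosed : ∀ i → DownClosed ⟦ E i ⟧ˢ
        members-within     : ∀ i → Within ⟦ E i ⟧ˢ
        reps-realizable    : ∀ j → T (realizable (rep j))
        reps-cover         : ∀ s → T (realizable s) → T (⟦ W ⟧ˢ s) → ∃ λ j → s ≼ rep j × rep j ≼ s
        profiles-cover     : ∀ v → DownClosedProfile v → ∃ λ i → profile ⟦ E i ⟧ˢ ≡ v
        profiles-distinct  : ∀ i j → profile ⟦ E i ⟧ˢ ≡ profile ⟦ E j ⟧ˢ → i ≡ j

    certificate? : Dec Certificate
    certificate? =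
      map′ (λ (a , b , c , d , e , f , g) → certificate a b c d e f g)
           (λ (certificate a b c d e f g) → a , b , c , d , e , f , g)
        ( downClosed? ⟦ W ⟧ˢ
        ×-dec ∀? indices (downClosed? ∘ ⟦_⟧ˢ ∘ E)
        ×-dec (∀? indices λ i → ∀? signatures λ s →
                 T? (realizable s) →-dec T? (⟦ E i ⟧ˢ s) →-dec T? (⟦ W ⟧ˢ s))
        ×-dec ∀? (fins R) (T? ∘ realizable ∘ rep)
        ×-dec (∀? signatures λ s → T? (realizable s) →-dec T? (⟦ W ⟧ˢ s) →-dec
                 ∃? (fins R) λ j → s ≼? rep j ×-dec rep j ≼? s)
        ×-dec (∀? (vectors R) λ v →
                 (∀? (fins R) λ j → ∀? (fins R) λ j′ →
                    rep j ≼? rep j′ →-dec T? (lookup v j′) →-dec T? (lookup v j))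
                 →-dec ∃? indices λ i → ≡-dec _≟_ (profile ⟦ E i ⟧ˢ) v)
        ×-dec (∀? indices λ i → ∀? indices λ j →
                 ≡-dec _≟_ (profile ⟦ E i ⟧ˢ) (profile ⟦ E j ⟧ˢ) →-dec Finite._≡?_ indices i j))

    module Certified (cert : Certificate) where
      open Certificate cert

      profile-lookup : ∀ P j → lookup (profile P) j ≡ P (rep j)
      profile-lookup P = lookup∘tabulate (P ∘ rep)

      window-closed : RClosed C ⟦ W ⟧
      window-closed =
        RClosed-≐ {C} {SigSet ⟦ W ⟧ˢ} (≐-sym (⟦⟧-sig W)) (SigSet-closed window-downClosed)

      closed : ∀ i → RClosed C ⟦ E i ⟧
      closed i =
        RClosed-≐ {C} {SigSet ⟦ E i ⟧ˢ} (≐-sym (⟦⟧-sig (E i))) (SigSet-closed (members-downClosed i))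

      within : ∀ i → ⟦ E i ⟧ ⊆ ⟦ W ⟧
      within i n f f∈Eᵢ = proj₂ (⟦⟧-sig W) n f
        (members-within i _ (realizable-sigOf f) (proj₁ (⟦⟧-sig (E i)) n f f∈Eᵢ))

      agree-on-reps : ∀ {P Q} → DownClosed P → DownClosed Q → Within P → Within Q →
        (∀ j → P (rep j) ≡ Q (rep j)) → P ≗ʳ Q
      agree-on-reps {P} {Q} dcP dcQ P⊆W Q⊆W agree s rs = by-window (T? (⟦ W ⟧ˢ s))
        where
        by-window : Dec (T (⟦ W ⟧ˢ s)) → P s ≡ Q s
        by-window (yes ws) = let (j , s≼rⱼ , rⱼ≼s) = reps-cover s rs ws in
          trans (downClosed-≈ dcP rs (reps-realizable j) s≼rⱼ rⱼ≼s)
                (trans (agree j) (downClosed-≈ dcQ (reps-realizable j) rs rⱼ≼s s≼rⱼ))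
        by-window (no ¬ws) = T-extensional (⊥-elim ∘ ¬ws ∘ P⊆W s rs) (⊥-elim ∘ ¬ws ∘ Q⊆W s rs)

      complete : ExcludedMiddle 0ℓ → ∀ K → RClosed C K → K ⊆ ⟦ W ⟧ → ∃[ i ] (K ≐ ⟦ E i ⟧)
      complete lem K rc K⊆W =
        i , ≐-trans (closed-≐-below lem rc) (≐-trans (SigSet-cong D≗Eᵢ) (≐-sym (⟦⟧-sig (E i))))
        where
        D = below lem K

        D⊆W : Within D
        D⊆W s rs Ds =
          let (n , f , fK , s≼f) = toWitness {a? = lem {Below lem K s}} Ds
          in window-downClosed _ _ rs (realizable-sigOf f) s≼f (proj₁ (⟦⟧-sig W) n f (K⊆W n f fK))

        profile-downClosed : DownClosedProfile (profile D)
        profile-downClosed j j′ rⱼ≼rⱼ′ =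
          subst T (sym (profile-lookup D j))
          ∘ below-downClosed lem K _ _ (reps-realizable j) (reps-realizable j′) rⱼ≼rⱼ′
          ∘ subst T (profile-lookup D j′)

        covered : ∃ λ i → profile ⟦ E i ⟧ˢ ≡ profile D
        covered = profiles-cover (profile D) profile-downClosed

        i : Idx
        i = proj₁ covered

        D≗Eᵢ : D ≗ʳ ⟦ E i ⟧ˢ
        D≗Eᵢ = agree-on-reps (below-downClosed lem K) (members-downClosed i) D⊆W (members-within i) λ j →
          trans (sym (profile-lookup D j))
                (trans (cong (λ v → lookup v j) (sym (proj₂ covered))) (profile-lookup ⟦ E i ⟧ˢ j))

      injective : ∀ i j → ⟦ E i ⟧ ≐ ⟦ E j ⟧ → i ≡ j
      injective i j Eᵢ≐Eⱼ = profiles-distinct i j (tabulate-cong λ r → agree (rep r) (reps-realizable r))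
        where
        agree : ⟦ E i ⟧ˢ ≗ʳ ⟦ E j ⟧ˢ
        agree = SigSet-injective (≐-trans (≐-sym (⟦⟧-sig (E i))) (≐-trans Eᵢ≐Eⱼ (⟦⟧-sig (E j))))

      classification : ExcludedMiddle 0ℓ → Ω ⊆ ⟦ W ⟧ → (U : Idx → BSet) →
        List.map (⟦_⟧ ∘ E) (elements indices) ≡ List.map U (elements indices) → Classification C Ic Idx U
      classification lem Ω⊆W U E≡U = Classification-resp {C} {Ic} (≗-by-enumeration indices _ _ E≡U)
        ( (λ i → closed i , Ic-absorbed ⟦ E i ⟧)
        , (λ K (rc , _) → complete lem K rc (λ n f _ → Ω⊆W n f tt))
        , injective )

  representativesIn : SetExpr → List Sig
  representativesIn W = List.deduplicate (λ s t → s ≼? t ×-dec t ≼? s)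
    (List.filterᵇ (λ s → realizable s ∧ ⟦ W ⟧ˢ s) (elements signatures))

  module CatalogueIn (W : SetExpr) {Idx : Set} (indices : Finite Idx) (E : Idx → SetExpr) =
    Catalogue W indices E (representativesIn W)

⋃ : (Bool → Bool → BSet) → BSet
⋃ F = F false false ∪ F false true ∪ F true false ∪ F true true

⋃-intro : ∀ F x y → F x y ⊆ ⋃ F
⋃-intro F false false n f = inj₁
⋃-intro F false true  n f = inj₂ ∘ inj₁
⋃-intro F true  false n f = inj₂ ∘ inj₂ ∘ inj₁
⋃-intro F true  true  n f = inj₂ ∘ inj₂ ∘ inj₂

⋃-elim : ∀ F {n f} → ⋃ F n f → ∃₂ λ x y → F x y n f
⋃-elim F (inj₁ z)               = false , false , z
⋃-elim F (inj₂ (inj₁ z))        = false , true , z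
⋃-elim F (inj₂ (inj₂ (inj₁ z))) = true , false , z
⋃-elim F (inj₂ (inj₂ (inj₂ z))) = true , true , z

⋃-mono : ∀ F G → (∀ x y → F x y ⊆ G x y) → ⋃ F ⊆ ⋃ G
⋃-mono F G F⊆G n f z = let (x , y , w) = ⋃-elim F z in ⋃-intro G x y n f (F⊆G x y n f w)

⋃-cong : ∀ F G → (∀ x y → F x y ≐ G x y) → ⋃ F ≐ ⋃ G
⋃-cong F G F≐G = ⋃-mono F G (λ x y → proj₁ (F≐G x y)) , ⋃-mono G F (λ x y → proj₂ (F≐G x y))

⋃-decompose : ∀ K → K ≐ ⋃ (λ x y → K ∩ Ωab x y)
⋃-decompose K =
  (λ n f fK → ⋃-intro (λ x y → K ∩ Ωab x y) (eval f 𝟎) (eval f 𝟏) n f (fK , refl , refl)) ,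
  (λ n f z → proj₁ (proj₂ (proj₂ (⋃-elim (λ x y → K ∩ Ωab x y) z))))

RClosed-⋃ : ∀ {C} F → (∀ x y → RClosed C (F x y)) → RClosed C (⋃ F)
RClosed-⋃ F rc k m f g z g∈C = let (x , y , w) = ⋃-elim F z in ⋃-intro F x y m _ (rc x y k m f g w g∈C)

Sliced : (Bool → Bool → BSet) → Set
Sliced F = ∀ x y → F x y ⊆ Ωab x y

⋃-slice : ∀ F → Sliced F → ∀ x y → (⋃ F ∩ Ωab x y) ⊆ F x y
⋃-slice F sliced x y n f (z , f𝟎≡x , f𝟏≡y) =
  let (x′ , y′ , w) = ⋃-elim F z
      (f𝟎≡x′ , f𝟏≡y′) = sliced x′ y′ n f w
  in subst₂ (λ a b → F a b n f) (trans (sym f𝟎≡x′) f𝟎≡x) (trans (sym f𝟏≡y′) f𝟏≡y) w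

⋃-⊆-slices : ∀ F G → Sliced F → Sliced G → ⋃ F ⊆ ⋃ G → ∀ x y → F x y ⊆ G x y
⋃-⊆-slices F G F-sliced G-sliced ⋃F⊆⋃G x y n f w =
  ⋃-slice G G-sliced x y n f (⋃F⊆⋃G n f (⋃-intro F x y n f w) , F-sliced x y n f w)

famᵉ : Bool → Bool → Fin 6 → SetExpr
famᵉ false false 0F = ∅ᵉ
famᵉ false false 1F = C₀ᵉ
famᵉ false false 2F = Reflᵉ ∩ᵉ Ωabᵉ false false
famᵉ false false 3F = Sminᵉ ∩ᵉ Ωabᵉ false false
famᵉ false false 4F = Reflᵉ ∩ᵉ Ωabᵉ false false ∪ᵉ Sminᵉ ∩ᵉ Ωabᵉ false false
famᵉ false false 5F = Ωabᵉ false false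
famᵉ false true  0F = ∅ᵉ
famᵉ false true  1F = Sᵉ ∩ᵉ Ωabᵉ false true
famᵉ false true  2F = Smajᵉ ∩ᵉ Ωabᵉ false true
famᵉ false true  3F = Sminᵉ ∩ᵉ Ωabᵉ false true
famᵉ false true  4F = Smajᵉ ∩ᵉ Ωabᵉ false true ∪ᵉ Sminᵉ ∩ᵉ Ωabᵉ false true
famᵉ false true  5F = Ωabᵉ false true
famᵉ true  false 0F = ∅ᵉ
famᵉ true  false 1F = Sᵉ ∩ᵉ Ωabᵉ true false
famᵉ true  false 2F = Smajᵉ ∩ᵉ Ωabᵉ true false
famᵉ true  false 3F = Sminᵉ ∩ᵉ Ωabᵉ true false
famᵉ true  false 4F = Smajᵉ ∩ᵉ Ωabᵉ true false ∪ᵉ Sminᵉ ∩ᵉ Ωabᵉ true false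
famᵉ true  false 5F = Ωabᵉ true false
famᵉ true  true  0F = ∅ᵉ
famᵉ true  true  1F = C₁ᵉ
famᵉ true  true  2F = Smajᵉ ∩ᵉ Ωabᵉ true true
famᵉ true  true  3F = Reflᵉ ∩ᵉ Ωabᵉ true true
famᵉ true  true  4F = Smajᵉ ∩ᵉ Ωabᵉ true true ∪ᵉ Reflᵉ ∩ᵉ Ωabᵉ true true
famᵉ true  true  5F = Ωabᵉ true true

fam : Bool → Bool → Fin 6 → BSet
fam false false = famA
fam false true  = famB
fam true  false = famC
fam true  true  = famD

module Slice (x y : Bool) = Classify.CatalogueIn Sc-order (Ωabᵉ x y) (fins 6) (famᵉ x y)

slice-certificate : ∀ x y → Slice.Certificate x y
slice-certificate false false = from-yes (Slice.certificate? false false)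
slice-certificate false true  = from-yes (Slice.certificate? false true)
slice-certificate true  false = from-yes (Slice.certificate? true false)
slice-certificate true  true  = from-yes (Slice.certificate? true true)

module CertifiedSlice (x y : Bool) = Slice.Certified x y (slice-certificate x y)

famᵉ≡fam : ∀ x y i → ⟦ famᵉ x y i ⟧ ≡ fam x y i
famᵉ≡fam false false = ≗-by-enumeration (fins 6) _ _ refl
famᵉ≡fam false true  = ≗-by-enumeration (fins 6) _ _ refl
famᵉ≡fam true  false = ≗-by-enumeration (fins 6) _ _ refl
famᵉ≡fam true  true  = ≗-by-enumeration (fins 6) _ _ refl

fam-closed : ∀ x y i → RClosed Sc (fam x y i)
fam-closed x y i = subst (RClosed Sc) (famᵉ≡fam x y i) (CertifiedSlice.closed x y i)

fam-within : ∀ x y i → fam x y i ⊆ Ωab x y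
fam-within x y i = subst (_⊆ Ωab x y) (famᵉ≡fam x y i) (CertifiedSlice.within x y i)

fam-complete : ExcludedMiddle 0ℓ → ∀ x y K → RClosed Sc K → K ⊆ Ωab x y → ∃[ i ] (K ≐ fam x y i)
fam-complete lem x y K rc K⊆Ωxy = ∃≐-resp (famᵉ≡fam x y) (CertifiedSlice.complete x y lem K rc K⊆Ωxy)

fam-injective : ∀ x y i j → fam x y i ≐ fam x y j → i ≡ j
fam-injective x y i j =
  CertifiedSlice.injective x y i j ∘ subst₂ _≐_ (sym (famᵉ≡fam x y i)) (sym (famᵉ≡fam x y j))

component : Idx-i → Bool → Bool → Fin 6
component (a , _ , _ , _) false false = a
component (_ , b , _ , _) false true  = b
component (_ , _ , c , _) true  false = c
component (_ , _ , _ , d) true  true  = d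

components-≡ : ∀ {i j} → (∀ x y → component i x y ≡ component j x y) → i ≡ j
components-≡ same =
  cong₂ _,_ (same false false) (cong₂ _,_ (same false true) (cong₂ _,_ (same true false) (same true true)))

-- U-i i is ⋃ (slices i) by definition
slices : Idx-i → Bool → Bool → BSet
slices i x y = fam x y (component i x y)

slices-sliced : ∀ i → Sliced (slices i)
slices-sliced i x y = fam-within x y (component i x y)

glue-slices : ∀ K →
  ∃[ a ] ((K ∩ Ωab false false) ≐ famA a) → ∃[ b ] ((K ∩ Ωab false true) ≐ famB b) →
  ∃[ c ] ((K ∩ Ωab true false) ≐ famC c) → ∃[ d ] ((K ∩ Ωab true true) ≐ famD d) → ∃[ i ] (K ≐ U-i i)
glue-slices K (a , A) (b , B) (c , C′) (d , D) = (a , b , c , d) ,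
  ≐-trans (⋃-decompose K) (⋃-cong (λ x y → K ∩ Ωab x y) (slices (a , b , c , d)) λ where
    false false → A
    false true  → B
    true  false → C′
    true  true  → D)

Sc-order-iso : ∀ i j → (U-i i ⊆ U-i j) ⇔ (i ≤-i j)
Sc-order-iso i j = mk⇔
  (λ Uᵢ⊆Uⱼ → let slice = ⋃-⊆-slices (slices i) (slices j) (slices-sliced i) (slices-sliced j) Uᵢ⊆Uⱼ
             in slice false false , slice false true , slice true false , slice true true)
  (λ (A⊆A′ , B⊆B′ , C⊆C′ , D⊆D′) → ⋃-mono (slices i) (slices j) λ where
     false false → A⊆A′
     false true  → B⊆B′
     true  false → C⊆C′
     true  true  → D⊆D′)

Sc-classification : ExcludedMiddle 0ℓ → Classification Sc Ic Idx-i U-i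
Sc-classification lem = clonoids , complete , injective
  where
  clonoids : ∀ i → IsClonoid Sc Ic (U-i i)
  clonoids i = RClosed-⋃ {Sc} (slices i) (λ x y → fam-closed x y (component i x y)) , Ic-absorbed (U-i i)

  complete : ∀ K → IsClonoid Sc Ic K → ∃[ i ] (K ≐ U-i i)
  complete K (rc , _) =
    glue-slices K (slice false false) (slice false true) (slice true false) (slice true true)
    where
    slice : ∀ x y → ∃[ i ] ((K ∩ Ωab x y) ≐ fam x y i)
    slice x y = fam-complete lem x y (K ∩ Ωab x y)
      (RClosed-∩ {Sc} rc (CertifiedSlice.window-closed x y)) (λ _ _ → proj₂)

  injective : ∀ i j → U-i i ≐ U-i j → i ≡ j
  injective i j (Uᵢ⊆Uⱼ , Uⱼ⊆Uᵢ) = components-≡ λ x y → fam-injective x y _ _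
    ( ⋃-⊆-slices (slices i) (slices j) (slices-sliced i) (slices-sliced j) Uᵢ⊆Uⱼ x y
    , ⋃-⊆-slices (slices j) (slices i) (slices-sliced j) (slices-sliced i) Uⱼ⊆Uᵢ x y )

U-iiᵉ : Fin 19 → SetExpr
U-iiᵉ i = lookup
  ( Ωᵉ
  ∷ Reflᵉ ∪ᵉ Sminᵉ ∪ᵉ Smajᵉ
  ∷ Reflᵉ ∪ᵉ Sminᵉ
  ∷ Reflᵉ ∪ᵉ Smajᵉ
  ∷ Sminᵉ ∪ᵉ Smajᵉ
  ∷ Smajᵉ ∪ᵉ C₀ᵉ
  ∷ Sminᵉ ∪ᵉ C₁ᵉ
  ∷ Reflᵉ ∪ᵉ Sᵉ
  ∷ Sminᵉ
  ∷ Smajᵉ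
  ∷ Reflᵉ
  ∷ Sᵉ ∪ᵉ Cᵉ
  ∷ Sᵉ ∪ᵉ C₀ᵉ
  ∷ Sᵉ ∪ᵉ C₁ᵉ
  ∷ Sᵉ
  ∷ Cᵉ
  ∷ C₀ᵉ
  ∷ C₁ᵉ
  ∷ ∅ᵉ
  ∷ []) i

U-iiiᵉ : Idx-iii → SetExpr
U-iiiᵉ (a , b , c , d) = A a ∪ᵉ B b ∪ᵉ C′ c ∪ᵉ D d
  where
  A D : Fin 3 → SetExpr
  A 0F = ∅ᵉ
  A 1F = C₀ᵉ
  A 2F = Ωabᵉ false false
  D 0F = ∅ᵉ
  D 1F = C₁ᵉ
  D 2F = Ωabᵉ true true
  B C′ : Fin 2 → SetExpr
  B 0F  = ∅ᵉ
  B 1F  = Ωabᵉ false true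
  C′ 0F = ∅ᵉ
  C′ 1F = Ωabᵉ true false

U-ivᵉ : Fin 3 × Fin 3 → SetExpr
U-ivᵉ (a , b) = A a ∪ᵉ B b
  where
  A B : Fin 3 → SetExpr
  A 0F = ∅ᵉ
  A 1F = C₀ᵉ
  A 2F = Ωa*ᵉ false
  B 0F = ∅ᵉ
  B 1F = C₁ᵉ
  B 2F = Ωa*ᵉ true

U-vᵉ : Fin 3 × Fin 3 → SetExpr
U-vᵉ (a , b) = A a ∪ᵉ B b
  where
  A B : Fin 3 → SetExpr
  A 0F = ∅ᵉ
  A 1F = C₀ᵉ
  A 2F = Ω*bᵉ false
  B 0F = ∅ᵉ
  B 1F = C₁ᵉ
  B 2F = Ω*bᵉ true

U-viᵉ : Fin 5 → SetExpr
U-viᵉ 0F = Ωᵉ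
U-viᵉ 1F = Cᵉ
U-viᵉ 2F = C₀ᵉ
U-viᵉ 3F = C₁ᵉ
U-viᵉ 4F = ∅ᵉ

module S-catalogue   = Classify.CatalogueIn S-order Ωᵉ (fins 19) U-iiᵉ
module Ω01-catalogue = Classify.CatalogueIn Ω01-order Ωᵉ (fins 3 ×ᶠ (fins 2 ×ᶠ (fins 2 ×ᶠ fins 3))) U-iiiᵉ
module Ω0*-catalogue = Classify.CatalogueIn Ω0*-order Ωᵉ (fins 3 ×ᶠ fins 3) U-ivᵉ
module Ω*1-catalogue = Classify.CatalogueIn Ω*1-order Ωᵉ (fins 3 ×ᶠ fins 3) U-vᵉ
module Ω-catalogue   = Classify.CatalogueIn Ω-order Ωᵉ (fins 5) U-viᵉ

theorem7p2 : ExcludedMiddle 0ℓ →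
    (Classification Sc Ic Idx-i U-i ×
      (∀ x y → (U-i x ⊆ U-i y) ⇔ (x ≤-i y))) ×
    Classification S Ic (Fin 19) U-ii ×
    Classification (Ωab false true) Ic Idx-iii U-iii ×
    Classification (Ωa* false) Ic (Fin 3 × Fin 3) U-iv ×
    Classification (Ω*b true) Ic (Fin 3 × Fin 3) U-v ×
    Classification Ω Ic (Fin 5) U-vi
theorem7p2 lem =
  (Sc-classification lem , Sc-order-iso) ,
  S-catalogue.Certified.classification   (from-yes S-catalogue.certificate?)   lem Ω⊆Ω U-ii refl ,
  Ω01-catalogue.Certified.classification (from-yes Ω01-catalogue.certificate?) lem Ω⊆Ω U-iii refl ,
  Ω0*-catalogue.Certified.classification (from-yes Ω0*-catalogue.certificate?) lem Ω⊆Ω U-iv refl ,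
  Ω*1-catalogue.Certified.classification (from-yes Ω*1-catalogue.certificate?) lem Ω⊆Ω U-v refl ,
  Ω-catalogue.Certified.classification   (from-yes Ω-catalogue.certificate?)   lem Ω⊆Ω U-vi refl
  where
  Ω⊆Ω : Ω ⊆ Ω
  Ω⊆Ω _ _ _ = tt
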